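{- If $G$ is a path or a cycle, then $\chi(G)-\varphi(G)=2$, where $\chi(G)$ is the chromatic number of $G$.
   Context: All graphs are simple, finite and have no isolated vertices (so a path has at least two vertices). For $A,B\subseteq\mathbb{N}_0$, $A+B=\{a+b: a\in A, b\in B\}$. An integer additive set-indexer (IASI) of $G$ is an injective $f:V(G)\to 2^{\mathbb{N}_0}$ such that $g_f(uv)=f(u)+f(v)$ is injective on $E(G)$. It is a weak IASI if $|g_f(uv)|=\max(|f(u)|,|f(v)|)$ for every edge $uv$. An edge is mono-indexed if its set-label has cardinality $1$. The sparing number $\varphi(G)$ is the minimum, over all weak IASIs of $G$, of the number of mono-indexed edges. -}

module Defs where

open import Data.Nat using (ℕ; zero; suc; _+_; _≤_; _⊔_; _≟_)
open import Data.Fin using (Fin; zero; suc; inject₁)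
open import Data.List using (List; []; _∷_; length; deduplicate; filter; concatMap; map)
open import Data.List.Membership.Propositional using (_∈_)
open import Data.Product using (Σ; _×_; _,_; proj₁; proj₂)
open import Data.Fin using () renaming (_≟_ to _≟ᶠ_)
open import Data.List using (allFin)
open import Relation.Binary.PropositionalEquality using (_≡_; _≢_)
open import Relation.Nullary using (¬_)
open import Data.Sum using (_⊎_)
open import Function.Bundles using (_⇔_)

record Graph : Set where
  field
    n    : ℕ
    m    : ℕ
    ends : Fin m → Fin n × Fin n
open Graph public

-- Path P_(k+2): vertices 0..k+1, edges i — i+1.
pathGraph : ℕ → Graph
pathGraph k = record { n = suc (suc k) ; m = suc k ; ends = λ i → (inject₁ i , suc i) }

sucMod : ∀ {n} → Fin (suc n) → Fin (suc n)
sucMod {zero}  zero    = zero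
sucMod {suc n} zero    = suc zero
sucMod {suc n} (suc i) with sucMod {n} i
... | zero  = zero
... | suc j = suc (suc j)

-- Cycle C_(k+3): vertices 0..k+2, edges i — (i+1 mod k+3).
cycleGraph : ℕ → Graph
cycleGraph k = record { n = suc (suc (suc k)) ; m = suc (suc (suc k)) ; ends = λ i → (i , sucMod i) }

IsMinimum : (ℕ → Set) → ℕ → Set
IsMinimum P k = P k × (∀ j → P j → k ≤ j)

ProperColouring : (G : Graph) (k : ℕ) → (Fin (n G) → Fin k) → Set
ProperColouring G k c = ∀ e → c (proj₁ (ends G e)) ≢ c (proj₂ (ends G e))

Colourable : Graph → ℕ → Set
Colourable G k = Σ (Fin (n G) → Fin k) (ProperColouring G k)

IsChromaticNumber : Graph → ℕ → Set
IsChromaticNumber G = IsMinimum (Colourable G)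

-- Finite subsets of ℕ₀ represented by lists (the set of their elements).
FinSet : Set
FinSet = List ℕ

SameSet : FinSet → FinSet → Set
SameSet A B = ∀ x → (x ∈ A) ⇔ (x ∈ B)

card : FinSet → ℕ
card A = length (deduplicate _≟_ A)

_⊕_ : FinSet → FinSet → FinSet
A ⊕ B = concatMap (λ a → map (a +_) B) A

module _ (G : Graph) (f : Fin (n G) → FinSet) where
  edgeLabel : Fin (m G) → FinSet
  edgeLabel e = f (proj₁ (ends G e)) ⊕ f (proj₂ (ends G e))

  IsIASI : Set
  IsIASI = (∀ u v → SameSet (f u) (f v) → u ≡ v)
         × (∀ e e′ → SameSet (edgeLabel e) (edgeLabel e′) → e ≡ e′)

  IsWeakIASI : Set
  IsWeakIASI = IsIASI
             × (∀ e → card (edgeLabel e) ≡ card (f (proj₁ (ends G e))) ⊔ card (f (proj₂ (ends G e))))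

  monoCount : ℕ
  monoCount = length (filter (λ e → card (edgeLabel e) ≟ 1) (allFin (m G)))

HasWeakIASIWithMono : Graph → ℕ → Set
HasWeakIASIWithMono G k = Σ (Fin (n G) → FinSet) (λ f → IsWeakIASI G f × monoCount G f ≡ k)

IsSparingNumber : Graph → ℕ → Set
IsSparingNumber G = IsMinimum (HasWeakIASIWithMono G)

IsPathOrCycle : Graph → Set
IsPathOrCycle G = Σ ℕ (λ k → (G ≡ pathGraph k)) ⊎ Σ ℕ (λ k → (G ≡ cycleGraph k))
  where

-- In a weak IASI no edge can join two vertices whose labels both have at least two
-- elements, because then |A + B| > max(|A|, |B|).  So every edge has an end with a
-- singleton label, and it is mono-indexed exactly when both ends have one.  A weak IASI
-- without mono-indexed edges therefore 2-colours the graph by "singleton label or not",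
-- which is impossible for an odd cycle: there φ ≥ 1.  Conversely, give the vertices of a
-- vertex cover S the labels {3w(v)} and the others {3w(v), 3w(v) + 1}, with weights w
-- whose sums over edges are distinct; this is a weak IASI whose mono-indexed edges are
-- the edges inside S.  Alternate vertices of a path or an even cycle form an independent
-- cover, giving φ = 0 = χ − 2, and an odd cycle has a cover with a single inner edge,
-- giving φ = 1 = χ − 2.

module Submission where

open import Defs
open import Data.Nat using (ℕ; zero; suc; pred; _+_; _*_; _≤_; _<_; _⊔_; _≟_; z≤n; s≤s; s≤s⁻¹; _/_; _%_; NonZero)
open import Data.Bool using (Bool; true; false; not; _∧_; _∨_; if_then_else_)
open import Data.Bool.Properties using (not-¬; ¬-not; not-involutive; ∨-inverseʳ; ∨-zeroʳ)
open import Data.Empty using (⊥-elim)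
open import Data.Fin using (Fin; zero; suc; toℕ; inject≤)
open import Data.Fin.Patterns using (0F; 1F; 2F)
open import Data.Fin.Properties using (toℕ-injective; toℕ-inject₁; toℕ-fromℕ<; inject≤-injective; 2↔Bool; 1↔⊤)
open import Data.List using (List; []; _∷_; length; map; filter; deduplicate; allFin)
open import Data.List.Extrema.Nat using (max; argmax-sel; xs≤max)
open import Data.List.Membership.Propositional using (_∈_; lose; find)
open import Data.List.Membership.Propositional.Properties
  using (∈-map⁺; ∈-map⁻; ∈-concatMap⁺; ∈-concatMap⁻; ∈-filter⁺; ∈-deduplicate⁺; ∈-deduplicate⁻; ∈-allFin)
open import Data.List.Properties using (length-map; filter-notAll; filter-none; filter-some; filter-accept)
open import Data.List.Relation.Binary.Subset.Propositional using (_⊆_)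
open import Data.List.Relation.Unary.All as All using (All; _∷_)
open import Data.List.Relation.Unary.All.Properties using (tabulate⁺)
open import Data.List.Relation.Unary.Any as Any using (here; there)
open import Data.List.Relation.Unary.Unique.Propositional using (Unique; []; _∷_)
open import Data.List.Relation.Unary.Unique.Propositional.Properties using (map⁺)
open import Data.List.Relation.Unary.Unique.DecPropositional.Properties _≟_ using (deduplicate-!)
open import Data.Nat.Properties
open import Data.Nat.DivMod using (_mod_; m*n/n≡m; m<n⇒m/n≡0; +-distrib-/-∣ˡ; m<n⇒m%n≡m; n%n≡0; m%n%n≡m%n; %-distribˡ-+)
open import Data.Nat.Divisibility using (divides-refl)
open import Data.Nat.Tactic.RingSolver using (solve-∀)
open import Data.Product using (Σ; ∃₂; _×_; _,_; proj₁; proj₂)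
open import Data.Sum using (_⊎_; inj₁; inj₂)
open import Function using (_∘_; Injection; Equivalence)
open import Function.Properties.Inverse using (↔⇒↣; ↔-sym)
open import Function.Properties.Equivalence using () renaming (refl to ⇔-refl)
open import Relation.Binary.Definitions using (tri<; tri≈; tri>)
open import Relation.Binary.PropositionalEquality
open import Relation.Nullary using (¬_; Dec; yes; no; does)
open import Relation.Nullary.Decidable using (¬?)
open import Relation.Unary using (Pred; Decidable)

open ≡-Reasoning

length-≤-⊆ : ∀ {xs ys : List ℕ} → Unique xs → xs ⊆ ys → length xs ≤ length ys
length-≤-⊆ {[]} [] _ = z≤n
length-≤-⊆ {x ∷ xs} {ys} (x∉xs ∷ xs-unique) x∷xs⊆ys = ≤-<-trans
  (length-≤-⊆ xs-unique xs⊆ys-x)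
  (filter-notAll (λ y → ¬? (x ≟ y)) ys (Any.map (λ x≡y x≢y → x≢y x≡y) (x∷xs⊆ys (here refl))))
  where
  xs⊆ys-x : xs ⊆ filter (λ y → ¬? (x ≟ y)) ys
  xs⊆ys-x y∈xs = ∈-filter⁺ (λ y → ¬? (x ≟ y)) (x∷xs⊆ys (there y∈xs)) (All.lookup x∉xs y∈xs)

length-≤-card : ∀ {xs} A → Unique xs → xs ⊆ A → length xs ≤ card A
length-≤-card A xs-unique xs⊆A = length-≤-⊆ xs-unique (λ z∈xs → ∈-deduplicate⁺ _≟_ (xs⊆A z∈xs))

card-mono : ∀ {A B} → A ⊆ B → card A ≤ card B
card-mono {A} {B} A⊆B = length-≤-card B (deduplicate-! A) (λ z∈ → A⊆B (∈-deduplicate⁻ _≟_ A z∈))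

∈-⊕⁺ : ∀ {a b A B} → a ∈ A → b ∈ B → a + b ∈ A ⊕ B
∈-⊕⁺ {a} {B = B} a∈A b∈B = ∈-concatMap⁺ (λ a → map (a +_) B) (lose a∈A (∈-map⁺ (a +_) b∈B))

∈-⊕⁻ : ∀ {z} A B → z ∈ A ⊕ B → ∃₂ λ a b → a ∈ A × b ∈ B × z ≡ a + b
∈-⊕⁻ A B z∈A⊕B with find (∈-concatMap⁻ (λ a → map (a +_) B) {xs = A} z∈A⊕B)
... | a , a∈A , z∈a+B with ∈-map⁻ (a +_) z∈a+B
... | b , b∈B , z≡a+b = a , b , a∈A , b∈B , z≡a+b

⊕-comm-⊆ : ∀ A B → A ⊕ B ⊆ B ⊕ A
⊕-comm-⊆ A B z∈A⊕B with ∈-⊕⁻ A B z∈A⊕B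
... | a , b , a∈A , b∈B , refl = subst (_∈ B ⊕ A) (+-comm b a) (∈-⊕⁺ b∈B a∈A)

card-⊕-comm : ∀ A B → card (A ⊕ B) ≡ card (B ⊕ A)
card-⊕-comm A B = ≤-antisym (card-mono (⊕-comm-⊆ A B)) (card-mono (⊕-comm-⊆ B A))

⊕-zeroʳ : ∀ A → A ⊕ [] ≡ []
⊕-zeroʳ [] = refl
⊕-zeroʳ (_ ∷ A) = ⊕-zeroʳ A

ordered-pair : ∀ {xs : List ℕ} → Unique xs → 2 ≤ length xs → ∃₂ λ x y → x ∈ xs × y ∈ xs × x < y
ordered-pair {x ∷ y ∷ _} ((x≢y ∷ _) ∷ _) _ with <-cmp x y
... | tri< x<y _ _ = x , y , here refl , there (here refl) , x<y
... | tri≈ _ x≡y _ = ⊥-elim (x≢y x≡y)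
... | tri> _ _ y<x = y , x , there (here refl) , here refl , y<x
ordered-pair {_ ∷ []} _ (s≤s ())

-- A + b₁ and max A + b₂ are card A + 1 distinct elements of A ⊕ B when b₁ < b₂.
cardˡ<card-⊕ : ∀ {a} A B → a ∈ A → 2 ≤ card B → card A < card (A ⊕ B)
cardˡ<card-⊕ {a} A B a∈A 2≤|B| with ordered-pair (deduplicate-! B) 2≤|B|
... | b₁ , b₂ , b₁∈ , b₂∈ , b₁<b₂ =
  subst (_≤ card (A ⊕ B)) (cong suc (length-map (_+ b₁) D)) (length-≤-card (A ⊕ B) unique ⊆A⊕B)
  where
  D = deduplicate _≟_ A
  top = max a A
  top∈A : top ∈ A
  top∈A with argmax-sel (λ x → x) a A
  ... | inj₁ top≡a = subst (_∈ A) (sym top≡a) a∈A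
  ... | inj₂ top∈A = top∈A
  below : ∀ {z} → z ∈ map (_+ b₁) D → z < top + b₂
  below z∈ with ∈-map⁻ (_+ b₁) z∈
  ... | d , d∈D , refl = +-mono-≤-< (All.lookup (xs≤max a A) (∈-deduplicate⁻ _≟_ A d∈D)) b₁<b₂
  unique : Unique (top + b₂ ∷ map (_+ b₁) D)
  unique = All.tabulate (λ z∈ → ≢-sym (<⇒≢ (below z∈))) ∷ map⁺ (+-cancelʳ-≡ _ _ _) (deduplicate-! A)
  ⊆A⊕B : top + b₂ ∷ map (_+ b₁) D ⊆ A ⊕ B
  ⊆A⊕B (here refl) = ∈-⊕⁺ top∈A (∈-deduplicate⁻ _≟_ B b₂∈)
  ⊆A⊕B (there z∈) with ∈-map⁻ (_+ b₁) z∈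
  ... | d , d∈D , refl = ∈-⊕⁺ (∈-deduplicate⁻ _≟_ A d∈D) (∈-deduplicate⁻ _≟_ B b₁∈)

cardʳ<card-⊕ : ∀ {b} A B → b ∈ B → 2 ≤ card A → card B < card (A ⊕ B)
cardʳ<card-⊕ A B b∈B 2≤|A| = <-≤-trans (cardˡ<card-⊕ B A b∈B 2≤|A|) (≤-reflexive (card-⊕-comm B A))

⊔<card-⊕ : ∀ A B → 2 ≤ card A → 2 ≤ card B → card A ⊔ card B < card (A ⊕ B)
⊔<card-⊕ (x ∷ A) (y ∷ B) 2≤|A| 2≤|B| =
  ⊔-lub (cardˡ<card-⊕ (x ∷ A) (y ∷ B) (here refl) 2≤|B|) (cardʳ<card-⊕ (x ∷ A) (y ∷ B) (here refl) 2≤|A|)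

sumset-card-⊔ : ∀ A B → card (A ⊕ B) ≡ card A ⊔ card B → (A ≡ [] × B ≡ []) ⊎ (card A ≡ 1 ⊎ card B ≡ 1)
sumset-card-⊔ [] [] _ = inj₁ (refl , refl)
sumset-card-⊔ [] (_ ∷ _) ()
sumset-card-⊔ (x ∷ A) [] eq = ⊥-elim (0≢1+n (trans (cong card (sym (⊕-zeroʳ (x ∷ A)))) eq))
sumset-card-⊔ (x ∷ A) (y ∷ B) eq
  with m≤n⇒m<n∨m≡n {1} {card (x ∷ A)} (s≤s z≤n) | m≤n⇒m<n∨m≡n {1} {card (y ∷ B)} (s≤s z≤n)
... | inj₂ 1≡|A| | _         = inj₂ (inj₁ (sym 1≡|A|))
... | inj₁ _     | inj₂ 1≡|B| = inj₂ (inj₂ (sym 1≡|B|))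
... | inj₁ 2≤|A| | inj₁ 2≤|B| = ⊥-elim (<-irrefl (sym eq) (⊔<card-⊕ (x ∷ A) (y ∷ B) 2≤|A| 2≤|B|))

IsMinimum-intro : ∀ {P : ℕ → Set} {k} → P k → (∀ j → j < k → ¬ P j) → IsMinimum P k
IsMinimum-intro Pk none-below = Pk , λ j Pj → ≮⇒≥ (λ j<k → none-below j j<k Pj)

colourable-mono : ∀ G {j k} → j ≤ k → Colourable G j → Colourable G k
colourable-mono G j≤k (c , proper) =
  (λ v → inject≤ (c v) j≤k) , λ e → proper e ∘ inject≤-injective j≤k j≤k _ _

¬colourable-1 : ∀ G → Fin (m G) → ¬ Colourable G 1
¬colourable-1 G e (c , proper) = proper e (Injection.injective (↔⇒↣ 1↔⊤) refl)

chromatic-suc : ∀ G {k} → Colourable G (suc k) → ¬ Colourable G k → IsChromaticNumber G (suc k)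
chromatic-suc G col ¬col =
  IsMinimum-intro col (λ j j<1+k col-j → ¬col (colourable-mono G (s≤s⁻¹ j<1+k) col-j))

bool-colourable : ∀ G (c : Fin (n G) → Bool) →
                  (∀ e → c (proj₁ (ends G e)) ≢ c (proj₂ (ends G e))) → Colourable G 2
bool-colourable G c proper = (to ∘ c) , λ e → proper e ∘ injective
  where open Injection (↔⇒↣ (↔-sym 2↔Bool)) using (to; injective)

module _ {m p} {P : Pred (Fin m) p} (P? : Decidable P) where

  count-none : (∀ i → ¬ P i) → length (filter P? (allFin m)) ≡ 0
  count-none ¬P = cong length (filter-none P? (tabulate⁺ ¬P))

  count-none⁻ : length (filter P? (allFin m)) ≡ 0 → ∀ i → ¬ P i
  count-none⁻ none i Pi = <⇒≢ (filter-some P? (lose (∈-allFin i) Pi)) (sym none)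

count-zero-only : ∀ {m p} {P : Pred (Fin (suc m)) p} (P? : Decidable P) →
                  P zero → (∀ i → ¬ P (suc i)) → length (filter P? (allFin (suc m))) ≡ 1
count-zero-only P? P0 ¬Psuc =
  cong length (trans (filter-accept P? P0) (cong (zero ∷_) (filter-none P? (tabulate⁺ ¬Psuc))))

≡⇒SameSet : ∀ {A B} → A ≡ B → SameSet A B
≡⇒SameSet refl _ = ⇔-refl

does-≡ : ∀ {p q} {P : Set p} {Q : Set q} (P? : Dec P) (Q? : Dec Q) →
         does P? ≡ does Q? → (P × Q) ⊎ (¬ P × ¬ Q)
does-≡ (yes p) (yes q) _ = inj₁ (p , q)
does-≡ (no ¬p) (no ¬q) _ = inj₂ (¬p , ¬q)

-- By sumset-card-⊔, the vertices with singleton labels form a colour class.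
mono-free⇒2-colourable : ∀ G f → IsWeakIASI G f → monoCount G f ≡ 0 →
                          (∀ e → proj₁ (ends G e) ≢ proj₂ (ends G e)) → Colourable G 2
mono-free⇒2-colourable G f ((f-injective , _) , weak) no-mono loopless =
  bool-colourable G singleton proper
  where
  singleton : Fin (n G) → Bool
  singleton v = does (card (f v) ≟ 1)
  proper : ∀ e → singleton (proj₁ (ends G e)) ≢ singleton (proj₂ (ends G e))
  proper e same-colour
    with does-≡ (card (f (proj₁ (ends G e))) ≟ 1) (card (f (proj₂ (ends G e))) ≟ 1) same-colour
  ... | inj₁ (|u|≡1 , |v|≡1) =
    count-none⁻ (λ e → card (edgeLabel G f e) ≟ 1) no-mono e (trans (weak e) (cong₂ _⊔_ |u|≡1 |v|≡1))
  ... | inj₂ (|u|≢1 , |v|≢1) with sumset-card-⊔ _ _ (weak e)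
  ...   | inj₁ (u≡[] , v≡[]) = loopless e (f-injective _ _ (≡⇒SameSet (trans u≡[] (sym v≡[]))))
  ...   | inj₂ (inj₁ |u|≡1) = |u|≢1 |u|≡1
  ...   | inj₂ (inj₂ |v|≡1) = |v|≢1 |v|≡1

end₁ end₂ : (G : Graph) → Fin (m G) → ℕ
end₁ G e = toℕ (proj₁ (ends G e))
end₂ G e = toℕ (proj₂ (ends G e))

AllEdges : Graph → (ℕ → ℕ → Set) → Set
AllEdges G R = ∀ e → R (end₁ G e) (end₂ G e)

path-allEdges : ∀ k (R : ℕ → ℕ → Set) → (∀ a → R a (suc a)) → AllEdges (pathGraph k) R
path-allEdges k R step e = subst (λ a → R a (suc (toℕ e))) (sym (toℕ-inject₁ e)) (step (toℕ e))

sucMod-cases : ∀ {n} (i : Fin (suc n)) →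
               toℕ i < n × toℕ (sucMod i) ≡ suc (toℕ i) ⊎ toℕ i ≡ n × toℕ (sucMod i) ≡ 0
sucMod-cases {zero} zero = inj₂ (refl , refl)
sucMod-cases {suc n} zero = inj₁ (s≤s z≤n , refl)
sucMod-cases {suc n} (suc i) with sucMod i | sucMod-cases i
... | zero  | inj₁ (_ , ())
... | zero  | inj₂ (i≡n , _) = inj₂ (cong suc i≡n , refl)
... | suc j | inj₁ (i<n , j≡1+i) = inj₁ (s≤s i<n , cong suc j≡1+i)
... | suc j | inj₂ (_ , ())

cycle-allEdges : ∀ k (R : ℕ → ℕ → Set) → (∀ a → a < suc (suc k) → R a (suc a)) → R (suc (suc k)) 0 →
                 AllEdges (cycleGraph k) R
cycle-allEdges k R step closing e with sucMod-cases e
... | inj₁ (e<last , e′≡1+e) = subst (R (toℕ e)) (sym e′≡1+e) (step (toℕ e) e<last)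
... | inj₂ (e≡last , e′≡0) = subst₂ R (sym e≡last) (sym e′≡0) closing

cycle-loopless : ∀ k e → proj₁ (ends (cycleGraph k) e) ≢ proj₂ (ends (cycleGraph k) e)
cycle-loopless k e = cycle-allEdges k _≢_ (λ a _ → ≢-sym 1+n≢n) (λ ()) e ∘ cong toℕ

toℕ-sucMod : ∀ {n} (i : Fin (suc n)) → toℕ (sucMod i) ≡ suc (toℕ i) % suc n
toℕ-sucMod {n} i with sucMod-cases i
... | inj₁ (i<n , eq) = trans eq (sym (m<n⇒m%n≡m (s≤s i<n)))
... | inj₂ (i≡n , eq) = trans eq (sym (trans (cong (λ r → suc r % suc n) i≡n) (n%n≡0 (suc n))))

sucMod-mod : ∀ {n} a → sucMod (a mod suc n) ≡ suc a mod suc n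
sucMod-mod {n} a = toℕ-injective (begin
  toℕ (sucMod (a mod N))          ≡⟨ toℕ-sucMod (a mod N) ⟩
  suc (toℕ (a mod N)) % N         ≡⟨ cong (λ r → suc r % N) (toℕ-fromℕ< _) ⟩
  (1 + a % N) % N                 ≡⟨ %-distribˡ-+ 1 (a % N) N ⟩
  (1 % N + a % N % N) % N         ≡⟨ cong (λ r → (1 % N + r) % N) (m%n%n≡m%n a N) ⟩
  (1 % N + a % N) % N             ≡⟨ %-distribˡ-+ 1 a N ⟨
  suc a % N                       ≡⟨ toℕ-fromℕ< _ ⟨
  toℕ (suc a mod N)               ∎)
  where N = suc n

alternating-double : ∀ (b : ℕ → Bool) → (∀ a → b (suc a) ≡ not (b a)) → ∀ i → b (i + i) ≡ b 0
alternating-double b alternates zero = refl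
alternating-double b alternates (suc i) = begin
  b (suc (i + suc i))        ≡⟨ cong (b ∘ suc) (+-suc i i) ⟩
  b (suc (suc (i + i)))      ≡⟨ alternates _ ⟩
  not (b (suc (i + i)))      ≡⟨ cong not (alternates _) ⟩
  not (not (b (i + i)))      ≡⟨ not-involutive _ ⟩
  b (i + i)                  ≡⟨ alternating-double b alternates i ⟩
  b 0                        ∎

alternating-odd≢0 : ∀ (b : ℕ → Bool) → (∀ a → b (suc a) ≡ not (b a)) → ∀ i → b (suc (i + i)) ≢ b 0
alternating-odd≢0 b alternates i odd≡0 =
  not-¬ (sym (alternating-double b alternates i)) (trans (sym odd≡0) (alternates (i + i)))

-- Along a ↦ a mod N, a 2-colouring of the cycle becomes an alternating sequence of period N.
odd-cycle-not-2-colourable : ∀ j → ¬ Colourable (cycleGraph (j + j)) 2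
odd-cycle-not-2-colourable j (c , proper) =
  alternating-odd≢0 b alternates (suc j) (trans (cong (λ a → b (suc (suc a))) (+-suc j j)) period)
  where
  open Injection (↔⇒↣ 2↔Bool) using (to; injective)
  N = suc (suc (suc (j + j)))
  b : ℕ → Bool
  b a = to (c (a mod N))
  alternates : ∀ a → b (suc a) ≡ not (b a)
  alternates a = ¬-not λ next≡this →
    proper (a mod N) (injective (trans (sym next≡this) (cong (to ∘ c) (sym (sucMod-mod a)))))
  period : b N ≡ b 0
  period = cong (to ∘ c) (toℕ-injective (trans (toℕ-fromℕ< _) (n%n≡0 N)))

increasing⇒monotone : ∀ (f : ℕ → ℕ) → (∀ a → f a < f (suc a)) → ∀ {a b} → a < b → f a < f b
increasing⇒monotone f increasing {a} {suc b} (s≤s a≤b) with m≤n⇒m<n∨m≡n a≤b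
... | inj₁ a<b  = <-trans (increasing⇒monotone f increasing a<b) (increasing b)
... | inj₂ refl = increasing a

increasing⇒injective : ∀ (f : ℕ → ℕ) → (∀ a → f a < f (suc a)) → ∀ {a b} → f a ≡ f b → a ≡ b
increasing⇒injective f increasing {a} {b} fa≡fb with <-cmp a b
... | tri< a<b _ _ = ⊥-elim (<-irrefl fa≡fb (increasing⇒monotone f increasing a<b))
... | tri≈ _ a≡b _ = a≡b
... | tri> _ _ b<a = ⊥-elim (<-irrefl (sym fa≡fb) (increasing⇒monotone f increasing b<a))

-- Odd only at 0: this is what tells the closing edge of a cycle apart from the others.
weight : ℕ → ℕ
weight zero    = 1
weight (suc a) = 2 * suc a

weight-increasing : ∀ a → weight a < weight (suc a)
weight-increasing zero    = s≤s (s≤s z≤n)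
weight-increasing (suc a) = *-monoʳ-< 2 (n<1+n (suc a))

weight-injective : ∀ {a b} → weight a ≡ weight b → a ≡ b
weight-injective = increasing⇒injective weight weight-increasing

consecutiveWeight : ℕ → ℕ
consecutiveWeight a = weight a + weight (suc a)

consecutiveWeight-injective : ∀ {a b} → consecutiveWeight a ≡ consecutiveWeight b → a ≡ b
consecutiveWeight-injective =
  increasing⇒injective consecutiveWeight (λ a → +-mono-< (weight-increasing a) (weight-increasing (suc a)))

closingWeight≢consecutiveWeight : ∀ k a → weight (suc (suc k)) + weight 0 ≢ consecutiveWeight a
closingWeight≢consecutiveWeight k zero eq
  with weight-injective {suc (suc k)} {1} (+-cancelˡ-≡ 1 _ _ (trans (+-comm 1 (weight (suc (suc k)))) eq))
... | ()
closingWeight≢consecutiveWeight k (suc a) eq = even≢odd (suc a + suc (suc a)) (suc (suc k)) (begin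
  2 * (suc a + suc (suc a))            ≡⟨ *-distribˡ-+ 2 (suc a) (suc (suc a)) ⟩
  consecutiveWeight (suc a)            ≡⟨ eq ⟨
  weight (suc (suc k)) + 1             ≡⟨ +-comm _ 1 ⟩
  suc (2 * suc (suc k))                ∎)

edgeWeight : (G : Graph) → Fin (m G) → ℕ
edgeWeight G e = weight (end₁ G e) + weight (end₂ G e)

EdgeWeightInjective : Graph → Set
EdgeWeightInjective G = ∀ e e′ → edgeWeight G e ≡ edgeWeight G e′ → e ≡ e′

path-edgeWeight-injective : ∀ k → EdgeWeightInjective (pathGraph k)
path-edgeWeight-injective k e e′ eq =
  toℕ-injective (consecutiveWeight-injective (trans (sym (consecutive e)) (trans eq (consecutive e′))))
  where
  consecutive : ∀ e → edgeWeight (pathGraph k) e ≡ consecutiveWeight (toℕ e)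
  consecutive e = cong (λ a → weight a + weight (suc (toℕ e))) (toℕ-inject₁ e)

cycle-consecutiveWeight : ∀ k {e} → toℕ (sucMod e) ≡ suc (toℕ e) →
                          edgeWeight (cycleGraph k) e ≡ consecutiveWeight (toℕ e)
cycle-consecutiveWeight k {e} e′≡1+e = cong (λ a → weight (toℕ e) + weight a) e′≡1+e

cycle-closingWeight : ∀ k {e} → toℕ e ≡ suc (suc k) → toℕ (sucMod e) ≡ 0 →
                      edgeWeight (cycleGraph k) e ≡ weight (suc (suc k)) + weight 0
cycle-closingWeight k = cong₂ (λ a b → weight a + weight b)

cycle-edgeWeight-injective : ∀ k → EdgeWeightInjective (cycleGraph k)
cycle-edgeWeight-injective k e e′ eq with sucMod-cases e | sucMod-cases e′
... | inj₁ (_ , s) | inj₁ (_ , s′) = toℕ-injective (consecutiveWeight-injective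
  (trans (sym (cycle-consecutiveWeight k s)) (trans eq (cycle-consecutiveWeight k s′))))
... | inj₂ (t , _) | inj₂ (t′ , _) = toℕ-injective (trans t (sym t′))
... | inj₁ (_ , s) | inj₂ (t′ , s′) = ⊥-elim (closingWeight≢consecutiveWeight k _
  (trans (sym (cycle-closingWeight k t′ s′)) (trans (sym eq) (cycle-consecutiveWeight k s))))
... | inj₂ (t , s) | inj₁ (_ , s′) = ⊥-elim (closingWeight≢consecutiveWeight k _
  (trans (sym (cycle-closingWeight k t s)) (trans eq (cycle-consecutiveWeight k s′))))

segment : Bool → ℕ → FinSet
segment true  x = x ∷ []
segment false x = x ∷ suc x ∷ []

width : Bool → ℕ
width true  = 1
width false = 2

head∈segment : ∀ s x → x ∈ segment s x
head∈segment true  x = here refl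
head∈segment false x = here refl

segment-offset : ∀ s x {z} → z ∈ segment s x → Σ ℕ λ r → r ≤ 1 × z ≡ x + r
segment-offset true  x (here refl)         = 0 , z≤n , sym (+-identityʳ x)
segment-offset false x (here refl)         = 0 , z≤n , sym (+-identityʳ x)
segment-offset false x (there (here refl)) = 1 , s≤s z≤n , +-comm 1 x

card-pair : ∀ x → card (x ∷ suc x ∷ []) ≡ 2
card-pair x = cong (suc ∘ length) (filter-accept (λ y → ¬? (x ≟ y)) (≢-sym 1+n≢n))

card-segment : ∀ s x → card (segment s x) ≡ width s
card-segment true  x = refl
card-segment false x = card-pair x

card-segment-⊕ : ∀ s t x y → s ∨ t ≡ true → card (segment s x ⊕ segment t y) ≡ width s ⊔ width t
card-segment-⊕ true  true  x y _ = refl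
card-segment-⊕ true  false x y _ = trans (cong (λ z → card (x + y ∷ z ∷ [])) (+-suc x y)) (card-pair (x + y))
card-segment-⊕ false true  x y _ = card-pair (x + y)

width⊔width≡1 : ∀ s t → width s ⊔ width t ≡ 1 → s ∧ t ≡ true
width⊔width≡1 true  true  _  = refl
width⊔width≡1 true  false ()
width⊔width≡1 false true  ()
width⊔width≡1 false false ()

[m*n+r]/n≡m : ∀ m {n r} .{{_ : NonZero n}} → r < n → (m * n + r) / n ≡ m
[m*n+r]/n≡m m {n} {r} r<n = begin
  (m * n + r) / n    ≡⟨ +-distrib-/-∣ˡ r (divides-refl m) ⟩
  m * n / n + r / n  ≡⟨ cong₂ _+_ (m*n/n≡m m n) (m<n⇒m/n≡0 r<n) ⟩
  m + 0              ≡⟨ +-identityʳ m ⟩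
  m                  ∎

segment-quotient : ∀ s x {z} → z ∈ segment s (x * 3) → z / 3 ≡ x
segment-quotient s x z∈ with segment-offset s _ z∈
... | r , r≤1 , refl = [m*n+r]/n≡m x (s≤s (m≤n⇒m≤1+n r≤1))

segment-⊕-quotient : ∀ s t x y {z} → z ∈ segment s (x * 3) ⊕ segment t (y * 3) → z / 3 ≡ x + y
segment-⊕-quotient s t x y z∈ with ∈-⊕⁻ (segment s (x * 3)) (segment t (y * 3)) z∈
... | p , q , p∈ , q∈ , refl with segment-offset s _ p∈ | segment-offset t _ q∈
... | r , r≤1 , refl | r′ , r′≤1 , refl =
  trans (cong (_/ 3) (regroup x y r r′)) ([m*n+r]/n≡m (x + y) (s≤s (+-mono-≤ r≤1 r′≤1)))
  where
  regroup : ∀ x y r r′ → (x * 3 + r) + (y * 3 + r′) ≡ (x + y) * 3 + (r + r′)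
  regroup = solve-∀

module _ (G : Graph) (S : ℕ → Bool) where

  -- Scaling the weights by 3 keeps the
  -- offsets 0, 1, 2 inside an edge label below the next multiple of 3, so z / 3 reads
  -- off the edge weight from any element z.
  labelling : Fin (n G) → FinSet
  labelling v = segment (S (toℕ v)) (weight (toℕ v) * 3)

  labelling-injective : ∀ u v → SameSet (labelling u) (labelling v) → u ≡ v
  labelling-injective u v same = toℕ-injective (weight-injective (begin
    weight (toℕ u)          ≡⟨ quotient u (head∈segment (S (toℕ u)) _) ⟨
    weight (toℕ u) * 3 / 3  ≡⟨ quotient v (Equivalence.to (same _) (head∈segment (S (toℕ u)) _)) ⟩
    weight (toℕ v)          ∎))
    where
    quotient : ∀ v {z} → z ∈ labelling v → z / 3 ≡ weight (toℕ v)
    quotient v = segment-quotient (S (toℕ v)) (weight (toℕ v))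

  edgeLabel-injective : EdgeWeightInjective G →
                        ∀ e e′ → SameSet (edgeLabel G labelling e) (edgeLabel G labelling e′) → e ≡ e′
  edgeLabel-injective weights-injective e e′ same = weights-injective e e′ (begin
    edgeWeight G e                                       ≡⟨ quotient e z∈e ⟨
    (weight (end₁ G e) * 3 + weight (end₂ G e) * 3) / 3  ≡⟨ quotient e′ (Equivalence.to (same _) z∈e) ⟩
    edgeWeight G e′                                      ∎)
    where
    quotient : ∀ e {z} → z ∈ edgeLabel G labelling e → z / 3 ≡ edgeWeight G e
    quotient e = segment-⊕-quotient (S (end₁ G e)) (S (end₂ G e)) (weight (end₁ G e)) (weight (end₂ G e))
    z∈e : weight (end₁ G e) * 3 + weight (end₂ G e) * 3 ∈ edgeLabel G labelling e
    z∈e = ∈-⊕⁺ (head∈segment (S (end₁ G e)) _) (head∈segment (S (end₂ G e)) _)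

  module _ (covering : AllEdges G (λ a b → S a ∨ S b ≡ true)) where

    card-edgeLabel : ∀ e → card (edgeLabel G labelling e) ≡ width (S (end₁ G e)) ⊔ width (S (end₂ G e))
    card-edgeLabel e = card-segment-⊕ (S (end₁ G e)) (S (end₂ G e)) _ _ (covering e)

    labelling-weak : EdgeWeightInjective G → IsWeakIASI G labelling
    labelling-weak weights-injective =
      (labelling-injective , edgeLabel-injective weights-injective) ,
      λ e → trans (card-edgeLabel e)
                  (sym (cong₂ _⊔_ (card-segment (S (end₁ G e)) _) (card-segment (S (end₂ G e)) _)))

    labelling-mono : ∀ e → card (edgeLabel G labelling e) ≡ 1 → S (end₁ G e) ∧ S (end₂ G e) ≡ true
    labelling-mono e mono = width⊔width≡1 (S (end₁ G e)) (S (end₂ G e)) (trans (sym (card-edgeLabel e)) mono)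

≢⇒∨ : ∀ {x y} → x ≢ y → x ∨ y ≡ true
≢⇒∨ {x} x≢y = subst (λ y → x ∨ y ≡ true) (sym (¬-not (≢-sym x≢y))) (∨-inverseʳ x)

≢⇒¬∧ : ∀ {x y} → x ≢ y → x ∧ y ≢ true
≢⇒¬∧ {true}  {true}  x≢y _ = x≢y refl
≢⇒¬∧ {true}  {false} _   ()
≢⇒¬∧ {false} {_}     _   ()

module _ (G : Graph) (S : ℕ → Bool) (alternating : AllEdges G (λ a b → S a ≢ S b)) where

  bipartite-chromatic : Fin (m G) → IsChromaticNumber G 2
  bipartite-chromatic e = chromatic-suc G (bool-colourable G (S ∘ toℕ) alternating) (¬colourable-1 G e)

  bipartite-sparing : EdgeWeightInjective G → IsSparingNumber G 0
  bipartite-sparing weights-injective = IsMinimum-intro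
    (labelling G S , labelling-weak G S covering weights-injective , count-none _ no-mono) (λ _ ())
    where
    covering : AllEdges G (λ a b → S a ∨ S b ≡ true)
    covering = ≢⇒∨ ∘ alternating
    no-mono : ∀ e → card (edgeLabel G (labelling G S) e) ≢ 1
    no-mono e = ≢⇒¬∧ (alternating e) ∘ labelling-mono G S covering e

isEven : ℕ → Bool
isEven zero    = true
isEven (suc a) = not (isEven a)

isEven-double : ∀ j → isEven (j + j) ≡ true
isEven-double = alternating-double isEven (λ _ → refl)

isEven-odd : ∀ j → isEven (suc (j + j)) ≡ false
isEven-odd j = cong not (isEven-double j)

parity : ∀ k → Σ ℕ (λ j → k ≡ j + j) ⊎ Σ ℕ (λ j → k ≡ suc (j + j))
parity zero = inj₁ (0 , refl)
parity (suc k) with parity k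
... | inj₁ (j , refl) = inj₂ (j , refl)
... | inj₂ (j , refl) = inj₁ (suc j , cong suc (sym (+-suc j j)))

path-alternating : ∀ k → AllEdges (pathGraph k) (λ a b → isEven a ≢ isEven b)
path-alternating k = path-allEdges k (λ a b → isEven a ≢ isEven b) (λ a → not-¬ refl)

path-chromatic : ∀ k → IsChromaticNumber (pathGraph k) 2
path-chromatic k = bipartite-chromatic (pathGraph k) isEven (path-alternating k) zero

path-sparing : ∀ k → IsSparingNumber (pathGraph k) 0
path-sparing k = bipartite-sparing (pathGraph k) isEven (path-alternating k) (path-edgeWeight-injective k)

even-cycle-alternating : ∀ j → AllEdges (cycleGraph (suc (j + j))) (λ a b → isEven a ≢ isEven b)
even-cycle-alternating j = cycle-allEdges (suc (j + j)) (λ a b → isEven a ≢ isEven b) (λ a _ → not-¬ refl)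
  (subst (_≢ true) (sym (trans (not-involutive _) (isEven-odd j))) (λ ()))

even-cycle-chromatic : ∀ j → IsChromaticNumber (cycleGraph (suc (j + j))) 2
even-cycle-chromatic j = bipartite-chromatic (cycleGraph (suc (j + j))) isEven (even-cycle-alternating j) zero

even-cycle-sparing : ∀ j → IsSparingNumber (cycleGraph (suc (j + j))) 0
even-cycle-sparing j = bipartite-sparing (cycleGraph (suc (j + j))) isEven (even-cycle-alternating j)
  (cycle-edgeWeight-injective (suc (j + j)))

three-colouring : ℕ → Fin 3
three-colouring zero    = 2F
three-colouring (suc a) = if isEven a then 0F else 1F

odd-cycle-chromatic : ∀ j → IsChromaticNumber (cycleGraph (j + j)) 3
odd-cycle-chromatic j = chromatic-suc (cycleGraph (j + j))
  (three-colouring ∘ toℕ , cycle-allEdges (j + j) (λ a b → three-colouring a ≢ three-colouring b)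
                            (λ a _ → step a) (closing (suc (j + j))))
  (odd-cycle-not-2-colourable j)
  where
  step : ∀ a → three-colouring a ≢ three-colouring (suc a)
  step zero = λ ()
  step (suc a) with isEven a
  ... | true  = λ ()
  ... | false = λ ()
  closing : ∀ a → three-colouring (suc a) ≢ three-colouring 0
  closing a with isEven a
  ... | true  = λ ()
  ... | false = λ ()

-- The singleton vertices are 0 and the odd ones, so the edge 0 — 1 is the only mono-indexed edge.
odd-cycle-sparing : ∀ j → IsSparingNumber (cycleGraph (j + j)) 1
odd-cycle-sparing j = IsMinimum-intro
  (labelling G S , labelling-weak G S covering (cycle-edgeWeight-injective (j + j)) ,
   count-zero-only (λ e → card (edgeLabel G (labelling G S) e) ≟ 1) refl only-first-mono)
  (λ { zero _ (f , weak , no-mono) → odd-cycle-not-2-colourable j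
                                       (mono-free⇒2-colourable G f weak no-mono (cycle-loopless (j + j)))
     ; (suc _) (s≤s ()) })
  where
  G = cycleGraph (j + j)
  S : ℕ → Bool
  S a = isEven (pred a)
  covering : AllEdges G (λ a b → S a ∨ S b ≡ true)
  covering = cycle-allEdges (j + j) (λ a b → S a ∨ S b ≡ true)
    (λ { zero _ → refl ; (suc a) _ → ∨-inverseʳ (isEven a) }) (∨-zeroʳ _)
  both-in-S⇒first : AllEdges G (λ a b → S a ∧ S b ≡ true → a ≡ 0)
  both-in-S⇒first = cycle-allEdges (j + j) (λ a b → S a ∧ S b ≡ true → a ≡ 0)
    (λ { zero _ _ → refl ; (suc a) _ both → ⊥-elim (≢⇒¬∧ (not-¬ {isEven a} refl) both) })
    (λ both → ⊥-elim (≢⇒¬∧ (subst (_≢ true) (sym (isEven-odd j)) (λ ())) both))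
  only-first-mono : ∀ i → card (edgeLabel G (labelling G S) (suc i)) ≢ 1
  only-first-mono i = 0≢1+n ∘ sym ∘ both-in-S⇒first (suc i) ∘ labelling-mono G S covering (suc i)

mainTheorem4 : (G : Graph) → IsPathOrCycle G →
    Σ ℕ (λ χ → Σ ℕ (λ φ → IsChromaticNumber G χ × IsSparingNumber G φ × χ ≡ φ + 2))
mainTheorem4 G (inj₁ (k , refl)) = 2 , 0 , path-chromatic k , path-sparing k , refl
mainTheorem4 G (inj₂ (k , refl)) with parity k
... | inj₁ (j , refl) = 3 , 1 , odd-cycle-chromatic j , odd-cycle-sparing j , refl
... | inj₂ (j , refl) = 2 , 0 , even-cycle-chromatic j , even-cycle-sparing j , refl
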